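{- Let $k$ be a positive integer and let $\mathbb{A}$ be an alphabet with exactly $k$ letters. Then the number of extremal $XY_1XY_2X$-avoiding words over $\mathbb{A}$ is $$\frac{(2k)!}{2^k}.$$
   Context: A word is a finite sequence of letters. A word $U$ is a factor of $W$ if $W=W_1UW_2$ for some (possibly empty) words $W_1,W_2$. A word realizes the pattern $XY_1XY_2X$ (with $X,Y_1,Y_2$ distinct pattern variables) if it can be written as $AB_1AB_2A$ with $A,B_1,B_2$ nonempty words (equalities among $A,B_1,B_2$ are allowed). A word contains the pattern if some factor realizes it, and avoids it otherwise. An extension of a word $W$ over $\mathbb{A}$ is any word $W_1xW_2$ with $W=W_1W_2$ ($W_1,W_2$ possibly empty) and $x\in\mathbb{A}$. A word is extremal $XY_1XY_2X$-avoiding if it avoids the pattern and every extension of it over $\mathbb{A}$ contains the pattern. -}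

module Defs where

open import Data.Nat using (ℕ; _*_; _^_; _!)
open import Data.Nat.Properties using (m^n≢0)
open import Data.Nat.DivMod using (_/_)
open import Data.Fin using (Fin)
open import Data.List using (List; []; _∷_; _++_)
open import Data.Product using (Σ; ∃; _×_)
open import Relation.Binary.PropositionalEquality using (_≡_)
open import Relation.Nullary using (¬_)

Word : ℕ → Set
Word k = List (Fin k)

Factor : ∀ {k} → Word k → Word k → Set
Factor U W = ∃ λ W₁ → ∃ λ W₂ → W ≡ W₁ ++ U ++ W₂

Realizes : ∀ {k} → Word k → Set
Realizes {k} W = Σ (Word k) λ A → Σ (Word k) λ B₁ → Σ (Word k) λ B₂ →
  ¬ (A ≡ []) × ¬ (B₁ ≡ []) × ¬ (B₂ ≡ []) × (W ≡ A ++ B₁ ++ A ++ B₂ ++ A)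

Contains : ∀ {k} → Word k → Set
Contains {k} W = Σ (Word k) λ U → Factor U W × Realizes U

Avoids : ∀ {k} → Word k → Set
Avoids W = ¬ Contains W

Extremal : ∀ {k} → Word k → Set
Extremal {k} W = Avoids W ×
  ((W₁ W₂ : Word k) (x : Fin k) → W ≡ W₁ ++ W₂ → Contains (W₁ ++ x ∷ W₂))

count : ℕ → ℕ
count k = _/_ ((2 * k) !) (2 ^ k) {{m^n≢0 2 k}}

-- Keeping only the first letter of A, a word contains X Y₁ X Y₂ X iff some letter x occurs three
-- times with no two of these occurrences adjacent, i.e. iff x y x z x is a subsequence for some y, z.
-- So an avoiding word has every letter at most four times, and an extremal one has every letter
-- exactly four times: a letter occurring at most three times can be prepended or doubled in place
-- without creating such a triple. An avoiding word whose letters all occur four times starts with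
-- y y, the remaining two y's are adjacent as well, and peeling pairs off the front shows that it is
-- double V = v₁ v₁ v₂ v₂ ⋯ for a word V using every letter exactly twice. Conversely every such
-- double V avoids the pattern, and each extension has a letter five times. The words using each of k
-- letters exactly twice arise from those on k − 1 letters by inserting two copies of the new letter,
-- in (2k − 1) 2k / 2 ways, which gives (2k)! / 2^k.
module Submission where

open import Defs
open import Data.Nat using (ℕ; zero; suc; _+_; _*_; _^_; _!; _≤_; z≤n; s≤s; s≤s⁻¹; NonZero)
open import Data.Nat.Properties
  using ( suc-injective; 0≢1+n; ≤-reflexive; ≤-antisym; ≮⇒≥; <⇒≱; <-irrefl
        ; n≤0⇒n≡0; +-suc; *-suc; *-distribˡ-+; *-cancelˡ-≡; m^n≢0)
open import Data.Nat.DivMod using (_/_; m*n/n≡m)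
open import Data.Nat.Tactic.RingSolver using (solve-∀)
open import Data.Fin using (Fin; zero; suc; _≟_)
import Data.Fin.Properties as Fin
open import Data.List using (List; []; _∷_; _++_; [_]; length; filter; map; replicate; concatMap)
open import Data.List.Properties
  using ( length-++; length-map; filter-++; filter-accept; filter-reject; ++-assoc
        ; ∷-injectiveˡ; ∷-injectiveʳ)
open import Data.List.Membership.Propositional using (_∈_; find; lose)
open import Data.List.Membership.Propositional.Properties
  using (∈-map⁺; ∈-map⁻; ∈-++⁺ˡ; ∈-++⁺ʳ; ∈-++⁻; ∈-concatMap⁺; ∈-concatMap⁻)
open import Data.List.Relation.Binary.Sublist.Propositional
  using (_⊆_; []; _∷_; _∷ʳ_; minimum; ⊆-refl; ⊆-trans)
open import Data.List.Relation.Binary.Sublist.Propositional.Properties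
  using (∷ˡ⁻; ∷⁻; ∷ʳ⁻; ++⁺; ++⁺ˡ; ++⁺ʳ; filter⁺; length-mono-≤)
open import Data.List.Relation.Unary.Any using (here; there)
import Data.List.Relation.Unary.All as All
import Data.List.Relation.Unary.All.Properties as All
import Data.List.Relation.Unary.AllPairs as AllPairs
import Data.List.Relation.Unary.AllPairs.Properties as AllPairs
open import Data.List.Relation.Unary.Linked using (Linked; [-]; _∷_)
import Data.List.Relation.Unary.Linked as Linked
open import Data.List.Relation.Unary.Unique.Propositional using (Unique; []; _∷_)
import Data.List.Relation.Unary.Unique.Propositional.Properties as Unique
open import Data.Product using (Σ; ∃; ∃₂; _×_; _,_; proj₁; proj₂; map₁; map₂)
open import Data.Sum using (_⊎_; inj₁; inj₂)
import Data.Sum as Sum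
open import Data.Empty using (⊥; ⊥-elim)
open import Function using (_∘_)
open import Function.Bundles using (_⇔_; mk⇔)
open import Relation.Nullary using (¬_; Dec; yes; no)
open import Relation.Binary.PropositionalEquality
  using (_≡_; _≢_; refl; sym; trans; cong; cong₂; subst; module ≡-Reasoning)

private
  variable
    k n : ℕ
    A : Set

double : List A → List A
double [] = []
double (a ∷ as) = a ∷ a ∷ double as

double-injective : ∀ {xs ys : List A} → double xs ≡ double ys → xs ≡ ys
double-injective {xs = []} {[]} _ = refl
double-injective {xs = x ∷ xs} {y ∷ ys} eq
  with refl ← ∷-injectiveˡ eq = cong (x ∷_) (double-injective (∷-injectiveʳ (∷-injectiveʳ eq)))

evens : List A → List A
evens (a ∷ _ ∷ as) = a ∷ evens as
evens as = as

-- Entries two apart in a sublist of double V come from different pairs of double V.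
evens-⊆-double : ∀ {p} (V : List A) → p ⊆ double V → evens p ⊆ V
evens-⊆-double [] [] = []
evens-⊆-double (v ∷ V) (v ∷ʳ (v ∷ʳ τ)) = v ∷ʳ evens-⊆-double V τ
evens-⊆-double {p = _ ∷ []} (v ∷ V) (v ∷ʳ (refl ∷ _)) = refl ∷ minimum V
evens-⊆-double {p = _ ∷ _ ∷ _} (v ∷ V) (v ∷ʳ (refl ∷ τ)) = refl ∷ evens-⊆-double V (∷ˡ⁻ τ)
evens-⊆-double {p = _ ∷ []} (v ∷ V) (refl ∷ _) = refl ∷ minimum V
evens-⊆-double {p = _ ∷ _ ∷ _} (v ∷ V) (refl ∷ τ) = refl ∷ evens-⊆-double V (∷⁻ τ)

⊆-split : ∀ p {x : A} {q W} → p ++ x ∷ q ⊆ W →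
  ∃₂ λ P R → W ≡ P ++ x ∷ R × p ⊆ P × q ⊆ R
⊆-split [] (refl ∷ τ) = [] , _ , refl , [] , τ
⊆-split (a ∷ p) (refl ∷ τ) with ⊆-split p τ
... | P , R , refl , σ , ρ = a ∷ P , R , refl , refl ∷ σ , ρ
⊆-split p (w ∷ʳ τ) with ⊆-split p τ
... | P , R , refl , σ , ρ = w ∷ P , R , refl , w ∷ʳ σ , ρ

[x]⊆⇒≢[] : ∀ {x : A} {xs} → [ x ] ⊆ xs → xs ≢ []
[x]⊆⇒≢[] (_ ∷ʳ _) ()
[x]⊆⇒≢[] (_ ∷ _) ()

⊆-merge-pair : ∀ U {x : A} {p V} → Linked (λ u v → ¬ (u ≡ x × v ≡ x)) p →
  p ⊆ U ++ x ∷ x ∷ V → p ⊆ U ++ x ∷ V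
⊆-merge-pair (u ∷ U) l (u ∷ʳ τ) = u ∷ʳ ⊆-merge-pair U l τ
⊆-merge-pair (u ∷ U) l (refl ∷ τ) = refl ∷ ⊆-merge-pair U (Linked.tail l) τ
⊆-merge-pair [] l (_ ∷ʳ τ) = τ
⊆-merge-pair [] l (refl ∷ (_ ∷ʳ τ)) = refl ∷ τ
⊆-merge-pair [] (not-both ∷ _) (refl ∷ (refl ∷ τ)) = ⊥-elim (not-both (refl , refl))

module _ {B : Set} (f : A → List B) where

  concatMap-unique : ∀ {xs} → Unique xs → (∀ x → Unique (f x)) →
    (∀ {x y w} → w ∈ f x → w ∈ f y → x ≡ y) → Unique (concatMap f xs)
  concatMap-unique xs! f! fibres =
    Unique.concat⁺ (All.map⁺ (All.universal f! _))
      (AllPairs.map⁺ {f = f} (AllPairs.map (λ x≢y {w} (w∈fx , w∈fy) → x≢y (fibres w∈fx w∈fy)) xs!))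

  length-concatMap : ∀ {xs c} → (∀ {x} → x ∈ xs → length (f x) ≡ c) →
    length (concatMap f xs) ≡ length xs * c
  length-concatMap {[]} _ = refl
  length-concatMap {x ∷ xs} lengths =
    trans (length-++ (f x)) (cong₂ _+_ (lengths (here refl)) (length-concatMap (lengths ∘ there)))

occurrences : Fin k → Word k → ℕ
occurrences x W = length (filter (x ≟_) W)

module _ {x : Fin k} where

  occurrences-here : ∀ W → occurrences x (x ∷ W) ≡ suc (occurrences x W)
  occurrences-here W = cong length (filter-accept (x ≟_) refl)

  occurrences-there : ∀ {y} W → x ≢ y → occurrences x (y ∷ W) ≡ occurrences x W
  occurrences-there W x≢y = cong length (filter-reject (x ≟_) x≢y)

  occurrences-++ : ∀ U W → occurrences x (U ++ W) ≡ occurrences x U + occurrences x W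
  occurrences-++ U W = trans (cong length (filter-++ (x ≟_) U W)) (length-++ (filter (x ≟_) U))

  occurrences-insert : ∀ U W → occurrences x (U ++ x ∷ W) ≡ suc (occurrences x (U ++ W))
  occurrences-insert U W = begin
    occurrences x (U ++ x ∷ W)                ≡⟨ occurrences-++ U (x ∷ W) ⟩
    occurrences x U + occurrences x (x ∷ W)   ≡⟨ cong (occurrences x U +_) (occurrences-here W) ⟩
    occurrences x U + suc (occurrences x W)   ≡⟨ +-suc _ _ ⟩
    suc (occurrences x U + occurrences x W)   ≡⟨ cong suc (occurrences-++ U W) ⟨
    suc (occurrences x (U ++ W))              ∎
    where open ≡-Reasoning

  occurrences-double : ∀ V → occurrences x (double V) ≡ 2 * occurrences x V
  occurrences-double [] = refl
  occurrences-double (v ∷ V) = by-cases (x ≟ v)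
    where
    open ≡-Reasoning
    by-cases : Dec (x ≡ v) → occurrences x (double (v ∷ V)) ≡ 2 * occurrences x (v ∷ V)
    by-cases (yes refl) = begin
      occurrences x (x ∷ x ∷ double V)   ≡⟨ occurrences-here _ ⟩
      suc (occurrences x (x ∷ double V)) ≡⟨ cong suc (occurrences-here _) ⟩
      2 + occurrences x (double V)       ≡⟨ cong (2 +_) (occurrences-double V) ⟩
      2 + 2 * occurrences x V            ≡⟨ *-suc 2 _ ⟨
      2 * suc (occurrences x V)          ≡⟨ cong (2 *_) (occurrences-here V) ⟨
      2 * occurrences x (x ∷ V)          ∎
    by-cases (no x≢v) = begin
      occurrences x (v ∷ v ∷ double V) ≡⟨ occurrences-there _ x≢v ⟩
      occurrences x (v ∷ double V)     ≡⟨ occurrences-there _ x≢v ⟩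
      occurrences x (double V)         ≡⟨ occurrences-double V ⟩
      2 * occurrences x V              ≡⟨ cong (2 *_) (occurrences-there V x≢v) ⟨
      2 * occurrences x (v ∷ V)        ∎

  occurrences-mono : ∀ {U W} → U ⊆ W → occurrences x U ≤ occurrences x W
  occurrences-mono τ = length-mono-≤ (filter⁺ (x ≟_) (x ≟_) (λ a≡b x≡a → trans x≡a a≡b) τ)

  occurrences-tail≡0 : ∀ {y} W → occurrences x (y ∷ W) ≡ 0 → occurrences x W ≡ 0
  occurrences-tail≡0 {y} W eq = n≤0⇒n≡0 (subst (_ ≤_) eq (occurrences-mono (y ∷ʳ ⊆-refl)))

  occurrences-replicate : ∀ n → occurrences x (replicate n x) ≡ n
  occurrences-replicate zero = refl
  occurrences-replicate (suc n) = trans (occurrences-here _) (cong suc (occurrences-replicate n))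

  replicate-⊆⇒≤ : ∀ {W} → replicate n x ⊆ W → n ≤ occurrences x W
  replicate-⊆⇒≤ {n} τ = subst (_≤ _) (occurrences-replicate n) (occurrences-mono τ)

  ≤⇒replicate-⊆ : ∀ {W} → n ≤ occurrences x W → replicate n x ⊆ W
  ≤⇒replicate-⊆ {zero} _ = minimum _
  ≤⇒replicate-⊆ {suc n} {y ∷ W} le = by-cases (x ≟ y)
    where
    by-cases : Dec (x ≡ y) → replicate (suc n) x ⊆ y ∷ W
    by-cases (yes refl) = refl ∷ ≤⇒replicate-⊆ (s≤s⁻¹ (subst (suc n ≤_) (occurrences-here W) le))
    by-cases (no x≢y) = y ∷ʳ ≤⇒replicate-⊆ (subst (suc n ≤_) (occurrences-there W x≢y) le)

  occurrences-split : ∀ W → occurrences x W ≡ suc n →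
    ∃₂ λ P R → W ≡ P ++ x ∷ R × occurrences x P ≡ 0 × occurrences x R ≡ n
  occurrences-split {n} (y ∷ W) eq = by-cases (x ≟ y)
    where
    by-cases : Dec (x ≡ y) →
      ∃₂ λ P R → y ∷ W ≡ P ++ x ∷ R × occurrences x P ≡ 0 × occurrences x R ≡ n
    by-cases (yes refl) = [] , W , refl , refl , suc-injective (trans (sym (occurrences-here W)) eq)
    by-cases (no x≢y) with occurrences-split W (trans (sym (occurrences-there W x≢y)) eq)
    ... | P , R , refl , P₀ , R₀ = y ∷ P , R , refl , trans (occurrences-there P x≢y) P₀ , R₀

-- The subsequence x y x z x records three occurrences of x, no two of them adjacent.
SpacedTriple : Fin k → Word k → Set
SpacedTriple x W = ∃₂ λ y z → x ∷ y ∷ x ∷ z ∷ x ∷ [] ⊆ W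

module _ {x : Fin k} where

  spacedTriple-intro : ∀ P {q r} Q R S →
    SpacedTriple x (P ++ x ∷ (q ∷ Q) ++ x ∷ (r ∷ R) ++ x ∷ S)
  spacedTriple-intro P Q R S =
    _ , _ , ++⁺ˡ P (refl ∷ refl ∷ ++⁺ˡ Q (refl ∷ refl ∷ ++⁺ˡ R (refl ∷ minimum S)))

  5≤occurrences⇒spacedTriple : ∀ {W} → 5 ≤ occurrences x W → SpacedTriple x W
  5≤occurrences⇒spacedTriple le = x , x , ≤⇒replicate-⊆ le

  spacedTriple⇒3≤occurrences : ∀ {W} → SpacedTriple x W → 3 ≤ occurrences x W
  spacedTriple⇒3≤occurrences (y , z , τ) =
    replicate-⊆⇒≤ (⊆-trans (refl ∷ y ∷ʳ refl ∷ z ∷ʳ refl ∷ []) τ)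

  spacedTriple-double⇒3≤occurrences : ∀ V → SpacedTriple x (double V) → 3 ≤ occurrences x V
  spacedTriple-double⇒3≤occurrences V (_ , _ , τ) = replicate-⊆⇒≤ (evens-⊆-double V τ)

  pair-skip : ∀ P {y p Q} → occurrences x P ≡ 0 → x ∷ y ∷ p ⊆ P ++ x ∷ x ∷ Q → p ⊆ Q
  pair-skip [] _ (refl ∷ refl ∷ τ) = τ
  pair-skip [] _ (refl ∷ _ ∷ʳ τ) = ∷ˡ⁻ τ
  pair-skip [] _ (_ ∷ʳ refl ∷ τ) = ∷ˡ⁻ τ
  pair-skip [] _ (_ ∷ʳ _ ∷ʳ τ) = ∷ˡ⁻ (∷ˡ⁻ τ)
  pair-skip (a ∷ P) P₀ (_ ∷ʳ τ) = pair-skip P (occurrences-tail≡0 P P₀) τ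
  pair-skip (a ∷ P) P₀ (refl ∷ _) with () ← trans (sym (occurrences-here {x = x} P)) P₀

  one-pair⇒¬spacedTriple : ∀ P R → occurrences x P ≡ 0 → occurrences x R ≤ 1 →
    ¬ SpacedTriple x (P ++ x ∷ x ∷ R)
  one-pair⇒¬spacedTriple P R P₀ R≤1 (_ , z , τ) =
    <⇒≱ (s≤s R≤1) (replicate-⊆⇒≤ (⊆-trans (refl ∷ z ∷ʳ refl ∷ []) (pair-skip P P₀ τ)))

  two-pairs⇒¬spacedTriple : ∀ P M N → occurrences x P ≡ 0 → occurrences x M ≡ 0 →
    occurrences x N ≡ 0 → ¬ SpacedTriple x (P ++ x ∷ x ∷ M ++ x ∷ x ∷ N)
  two-pairs⇒¬spacedTriple P M N P₀ M₀ N₀ (_ , _ , τ) =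
    <⇒≱ (s≤s (≤-reflexive N₀)) (replicate-⊆⇒≤ (pair-skip M M₀ (pair-skip P P₀ τ)))

  spacedTriple-merge-pair : ∀ {b} U V → b ≢ x →
    SpacedTriple b (U ++ x ∷ x ∷ V) → SpacedTriple b (U ++ x ∷ V)
  spacedTriple-merge-pair U V b≢x (y , z , τ) =
    y , z , ⊆-merge-pair U (left ∷ right ∷ left ∷ right ∷ [-]) τ
    where
    left : ∀ {v} → ¬ (_ ≡ x × v ≡ x)
    left (b≡x , _) = b≢x b≡x
    right : ∀ {u} → ¬ (u ≡ x × _ ≡ x)
    right (_ , b≡x) = b≢x b≡x

contains⇒spacedTriple : ∀ {W : Word k} → Contains W → ∃ λ x → SpacedTriple x W
contains⇒spacedTriple (_ , _ , ([] , _ , _ , A≢[] , _)) = ⊥-elim (A≢[] refl)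
contains⇒spacedTriple (_ , _ , (_ , [] , _ , _ , B₁≢[] , _)) = ⊥-elim (B₁≢[] refl)
contains⇒spacedTriple (_ , _ , (_ , _ , [] , _ , _ , B₂≢[] , _)) = ⊥-elim (B₂≢[] refl)
contains⇒spacedTriple (_ , (W₁ , W₂ , refl) , (a ∷ A , b ∷ B₁ , c ∷ B₂ , _ , _ , _ , refl)) =
  a , b , c , ++⁺ˡ W₁ (++⁺ʳ W₂ (++⁺ (head A) (++⁺ (head B₁) (++⁺ (head A) (++⁺ (head B₂) (head A))))))
  where
  head : ∀ {x : Fin _} xs → [ x ] ⊆ x ∷ xs
  head xs = refl ∷ minimum xs

spacedTriple⇒contains : ∀ {x} {W : Word k} → SpacedTriple x W → Contains W
spacedTriple⇒contains {x = x} (y , z , τ) with ⊆-split [] τ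
... | P , _ , refl , _ , τ₁ with ⊆-split [ y ] τ₁
... | Q , _ , refl , y∈Q , τ₂ with ⊆-split [ z ] τ₂
... | Q′ , S , refl , z∈Q′ , _ =
  x ∷ Q ++ x ∷ Q′ ++ [ x ] , (P , S , cong (P ++_) (sym reassociate)) ,
  [ x ] , Q , Q′ , (λ ()) , [x]⊆⇒≢[] y∈Q , [x]⊆⇒≢[] z∈Q′ , refl
  where
  reassociate : (x ∷ Q ++ x ∷ Q′ ++ [ x ]) ++ S ≡ x ∷ Q ++ x ∷ Q′ ++ x ∷ S
  reassociate = cong (x ∷_) (trans (++-assoc Q _ S) (cong (λ t → Q ++ x ∷ t) (++-assoc Q′ _ S)))

avoids-suffix : ∀ U {W : Word k} → Avoids (U ++ W) → Avoids W
avoids-suffix U av (V , (W₁ , W₂ , refl) , r) = av (V , (U ++ W₁ , W₂ , sym (++-assoc U W₁ _)) , r)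

-- Extremal words

module _ {W : Word k} (E : Extremal W) {x : Fin k} where

  private
    avoids : Avoids W
    avoids = proj₁ E

  extremal-prepend : SpacedTriple x (x ∷ W)
  extremal-prepend with contains⇒spacedTriple (proj₂ E [] W x refl)
  ... | b , t with b ≟ x
  ... | yes refl = t
  ... | no b≢x with y , z , τ ← t = ⊥-elim (avoids (spacedTriple⇒contains (y , z , ∷ʳ⁻ b≢x τ)))

  extremal-duplicate : ∀ U V → W ≡ U ++ x ∷ V → SpacedTriple x (U ++ x ∷ x ∷ V)
  extremal-duplicate U V eq with contains⇒spacedTriple (proj₂ E U (x ∷ V) x eq)
  ... | b , t with b ≟ x
  ... | yes refl = t
  ... | no b≢x = ⊥-elim (avoids (subst Contains (sym eq)
                   (spacedTriple⇒contains (spacedTriple-merge-pair U V b≢x t))))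

  occurrences≢0 : occurrences x W ≢ 0
  occurrences≢0 eq = <⇒≱ (s≤s (s≤s z≤n))
    (subst (3 ≤_) (trans (occurrences-here W) (cong suc eq)) (spacedTriple⇒3≤occurrences extremal-prepend))

  occurrences≢1+n : n ≤ 1 → occurrences x W ≢ suc n
  occurrences≢1+n n≤1 eq with P , R , W≡ , P₀ , Rₙ ← occurrences-split W eq =
    one-pair⇒¬spacedTriple P R P₀ (subst (_≤ 1) (sym Rₙ) n≤1) (extremal-duplicate P R W≡)

  occurrences≢3 : occurrences x W ≢ 3
  occurrences≢3 eq with occurrences-split W eq
  ... | P , R , W≡ , P₀ , R₂ with occurrences-split R R₂
  ... | M , R′ , refl , M₀ , R′₁ with occurrences-split R′ R′₁
  ... | M′ , N , refl , M′₀ , N₀ = gaps M M′ M₀ M′₀ W≡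
    where
    gaps : ∀ M M′ → occurrences x M ≡ 0 → occurrences x M′ ≡ 0 →
      W ≡ P ++ x ∷ M ++ x ∷ M′ ++ x ∷ N → ⊥
    gaps (_ ∷ M) (_ ∷ M′) _ _ W≡ =
      avoids (subst Contains (sym W≡) (spacedTriple⇒contains (spacedTriple-intro P M M′ N)))
    gaps M [] M₀ _ W≡ = two-pairs⇒¬spacedTriple P M N P₀ M₀ N₀ (extremal-duplicate P _ W≡)
    gaps [] M′ _ M′₀ W≡ = two-pairs⇒¬spacedTriple P M′ N P₀ M′₀ N₀
      (subst (SpacedTriple x) (++-assoc P _ _)
        (extremal-duplicate (P ++ x ∷ x ∷ M′) N (trans W≡ (sym (++-assoc P _ _)))))

  extremal⇒occurrences≡4 : occurrences x W ≡ 4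
  extremal⇒occurrences≡4 = ≤-antisym at-most-4 at-least-4
    where
    at-most-4 : occurrences x W ≤ 4
    at-most-4 = ≮⇒≥ (λ 5≤ → avoids (spacedTriple⇒contains (5≤occurrences⇒spacedTriple 5≤)))
    at-least-4 : 4 ≤ occurrences x W
    at-least-4 with occurrences x W in eq
    ... | 0 = ⊥-elim (occurrences≢0 eq)
    ... | 1 = ⊥-elim (occurrences≢1+n z≤n eq)
    ... | 2 = ⊥-elim (occurrences≢1+n (s≤s z≤n) eq)
    ... | 3 = ⊥-elim (occurrences≢3 eq)
    ... | suc (suc (suc (suc _))) = s≤s (s≤s (s≤s (s≤s z≤n)))

AdjacentPair : Fin k → Word k → Set
AdjacentPair z W = ∃₂ λ P N → W ≡ P ++ z ∷ z ∷ N × occurrences z P ≡ 0 × occurrences z N ≡ 0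

adjacentPair⇒2≤occurrences : ∀ {z} {W : Word k} → AdjacentPair z W → 2 ≤ occurrences z W
adjacentPair⇒2≤occurrences (P , N , refl , _) = replicate-⊆⇒≤ (++⁺ˡ P (refl ∷ refl ∷ minimum N))

-- What is left of a word whose letters all occur four times after peeling pairs off its front:
-- each letter is used up, untouched, or down to its second pair.
QuadOrPaired : Word k → Set
QuadOrPaired W = ∀ z → occurrences z W ≡ 0 ⊎ occurrences z W ≡ 4 ⊎ AdjacentPair z W

¬quadOrPaired-singleton : ∀ (y : Fin k) → ¬ QuadOrPaired [ y ]
¬quadOrPaired-singleton y inv with inv y | occurrences-here {x = y} []
... | inj₁ eq | once = 0≢1+n (trans (sym eq) once)
... | inj₂ (inj₁ eq) | once with () ← trans (sym once) eq
... | inj₂ (inj₂ pair) | once = <⇒≱ (s≤s (s≤s z≤n)) (subst (2 ≤_) once (adjacentPair⇒2≤occurrences pair))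

peel-quad : ∀ {y y′ : Fin k} {W} → Avoids (y ∷ y′ ∷ W) → occurrences y (y′ ∷ W) ≡ 3 →
  y′ ≡ y × AdjacentPair y W
peel-quad {y = y} {y′} {W} av eq with y′ ≟ y
... | no y′≢y =
  ⊥-elim (av (spacedTriple⇒contains (y′ , y , refl ∷ refl ∷ ≤⇒replicate-⊆ (≤-reflexive (sym three)))))
  where
  three : occurrences y W ≡ 3
  three = trans (sym (occurrences-there W (y′≢y ∘ sym))) eq
... | yes refl with occurrences-split {x = y} W (suc-injective (trans (sym (occurrences-here W)) eq))
... | P , R , refl , P₀ , R₁ with occurrences-split R R₁
... | [] , N , refl , _ , N₀ = refl , P , N , refl , P₀ , N₀
... | _ ∷ M , N , refl , _ = ⊥-elim (av (spacedTriple⇒contains (spacedTriple-intro [] P M N)))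

peel : ∀ {y y′ : Fin k} {W} → Avoids (y ∷ y′ ∷ W) → QuadOrPaired (y ∷ y′ ∷ W) →
  y′ ≡ y × (occurrences y W ≡ 0 ⊎ AdjacentPair y W)
peel {y = y} {W = W} av inv with inv y | occurrences-here {x = y} (_ ∷ W)
... | inj₁ eq | first = ⊥-elim (0≢1+n (trans (sym eq) first))
... | inj₂ (inj₁ eq) | first with y′≡y , pair ← peel-quad av (suc-injective (trans (sym first) eq)) =
  y′≡y , inj₂ pair
... | inj₂ (inj₂ ([] , N , refl , _ , N₀)) | _ = refl , inj₁ N₀
... | inj₂ (inj₂ (p ∷ P , N , eq , P₀ , _)) | _ with refl ← ∷-injectiveˡ eq =
  ⊥-elim (0≢1+n (trans (sym P₀) (occurrences-here {x = y} P)))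

quadOrPaired-tail : ∀ {y : Fin k} {W} → QuadOrPaired (y ∷ y ∷ W) →
  occurrences y W ≡ 0 ⊎ AdjacentPair y W → QuadOrPaired W
quadOrPaired-tail {y = y} {W} inv y-left z = by-cases (z ≟ y)
  where
  by-cases : Dec (z ≡ y) → occurrences z W ≡ 0 ⊎ occurrences z W ≡ 4 ⊎ AdjacentPair z W
  by-cases (yes refl) = Sum.map₂ inj₂ y-left
  by-cases (no z≢y) = Sum.map (trans (sym same)) (Sum.map (trans (sym same)) drop-pair) (inv z)
    where
    same : occurrences z (y ∷ y ∷ W) ≡ occurrences z W
    same = trans (occurrences-there _ z≢y) (occurrences-there W z≢y)
    drop-pair : AdjacentPair z (y ∷ y ∷ W) → AdjacentPair z W
    drop-pair ([] , _ , eq , _) = ⊥-elim (z≢y (sym (∷-injectiveˡ eq)))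
    drop-pair (_ ∷ [] , _ , eq , _) = ⊥-elim (z≢y (sym (∷-injectiveˡ (∷-injectiveʳ eq))))
    drop-pair (_ ∷ _ ∷ P , N , eq , P₀ , N₀) =
      P , N , ∷-injectiveʳ (∷-injectiveʳ eq) ,
      occurrences-tail≡0 {x = z} P (occurrences-tail≡0 {x = z} (_ ∷ P) P₀) , N₀

avoids-quadOrPaired⇒double : ∀ (W : Word k) → Avoids W → QuadOrPaired W → ∃ λ V → W ≡ double V
avoids-quadOrPaired⇒double [] _ _ = [] , refl
avoids-quadOrPaired⇒double (y ∷ []) _ inv = ⊥-elim (¬quadOrPaired-singleton y inv)
avoids-quadOrPaired⇒double (y ∷ y′ ∷ W) av inv with peel av inv
... | refl , y-left
  with V , refl ← avoids-quadOrPaired⇒double W (avoids-suffix (y ∷ y ∷ []) av)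
                                             (quadOrPaired-tail inv y-left) =
  y ∷ V , refl

DoubleOccurrence : Word k → Set
DoubleOccurrence V = ∀ z → occurrences z V ≡ 2

extremal⇒double : ∀ {W : Word k} → Extremal W → ∃ λ V → DoubleOccurrence V × W ≡ double V
extremal⇒double {W = W} E
  with V , refl ← avoids-quadOrPaired⇒double W (proj₁ E) (λ z → inj₂ (inj₁ (extremal⇒occurrences≡4 E))) =
  V , (λ z → *-cancelˡ-≡ _ 2 2 (trans (sym (occurrences-double V)) (extremal⇒occurrences≡4 E))) , refl

double-extremal : ∀ {V : Word k} → DoubleOccurrence V → Extremal (double V)
double-extremal {V = V} twice = avoids , extensions-contain
  where
  avoids : Avoids (double V)
  avoids c with x , t ← contains⇒spacedTriple c =
    <-irrefl refl (subst (3 ≤_) (twice x) (spacedTriple-double⇒3≤occurrences V t))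
  extensions-contain : ∀ W₁ W₂ x → double V ≡ W₁ ++ W₂ → Contains (W₁ ++ x ∷ W₂)
  extensions-contain W₁ W₂ x eq =
    spacedTriple⇒contains (5≤occurrences⇒spacedTriple (≤-reflexive (sym five)))
    where
    open ≡-Reasoning
    five : occurrences x (W₁ ++ x ∷ W₂) ≡ 5
    five = begin
      occurrences x (W₁ ++ x ∷ W₂)    ≡⟨ occurrences-insert W₁ W₂ ⟩
      suc (occurrences x (W₁ ++ W₂))  ≡⟨ cong (suc ∘ occurrences x) eq ⟨
      suc (occurrences x (double V))  ≡⟨ cong suc (occurrences-double V) ⟩
      suc (2 * occurrences x V)       ≡⟨ cong (λ n → suc (2 * n)) (twice x) ⟩
      5                               ∎

-- Counting the words in which every letter occurs twice

triangular : ℕ → ℕ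
triangular zero = 0
triangular (suc n) = suc n + triangular n

2*triangular : ∀ n → 2 * triangular n ≡ n * suc n
2*triangular zero = refl
2*triangular (suc n) = begin
  2 * (suc n + triangular n)      ≡⟨ *-distribˡ-+ 2 (suc n) (triangular n) ⟩
  2 * suc n + 2 * triangular n    ≡⟨ cong (2 * suc n +_) (2*triangular n) ⟩
  2 * suc n + n * suc n           ≡⟨ step n ⟩
  suc n * suc (suc n)             ∎
  where
  open ≡-Reasoning
  step : ∀ n → 2 * suc n + n * suc n ≡ suc n * suc (suc n)
  step = solve-∀

deleteZeros : Word (suc k) → Word k
deleteZeros [] = []
deleteZeros (zero ∷ W) = deleteZeros W
deleteZeros (suc a ∷ W) = a ∷ deleteZeros W

deleteZeros-map-suc : ∀ (V : Word k) → deleteZeros (map suc V) ≡ V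
deleteZeros-map-suc [] = refl
deleteZeros-map-suc (v ∷ V) = cong (v ∷_) (deleteZeros-map-suc V)

occurrences-zero-map-suc : ∀ (V : Word k) → occurrences zero (map suc V) ≡ 0
occurrences-zero-map-suc [] = refl
occurrences-zero-map-suc (v ∷ V) = occurrences-zero-map-suc V

occurrences-zero≡0⇒map-suc : ∀ (W : Word (suc k)) → occurrences zero W ≡ 0 → W ≡ map suc (deleteZeros W)
occurrences-zero≡0⇒map-suc [] _ = refl
occurrences-zero≡0⇒map-suc (suc a ∷ W) eq = cong (suc a ∷_) (occurrences-zero≡0⇒map-suc W eq)

occurrences-suc : ∀ (z : Fin k) W → occurrences (suc z) W ≡ occurrences z (deleteZeros W)
occurrences-suc z [] = refl
occurrences-suc z (zero ∷ W) = occurrences-suc z W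
occurrences-suc z (suc a ∷ W) = by-cases (z ≟ a)
  where
  by-cases : Dec (z ≡ a) → occurrences (suc z) (suc a ∷ W) ≡ occurrences z (a ∷ deleteZeros W)
  by-cases (yes refl) =
    trans (occurrences-here W) (trans (cong suc (occurrences-suc z W)) (sym (occurrences-here {x = z} _)))
  by-cases (no z≢a) =
    trans (occurrences-there W (z≢a ∘ Fin.suc-injective))
      (trans (occurrences-suc z W) (sym (occurrences-there {x = z} _ z≢a)))

length-deleteZeros : ∀ (W : Word (suc k)) → length W ≡ occurrences zero W + length (deleteZeros W)
length-deleteZeros [] = refl
length-deleteZeros (zero ∷ W) = cong suc (length-deleteZeros W)
length-deleteZeros (suc a ∷ W) = trans (cong suc (length-deleteZeros W)) (sym (+-suc _ _))

insertZero : Word k → List (Word (suc k))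
insertZero [] = [ [ zero ] ]
insertZero (v ∷ V) = (zero ∷ map suc (v ∷ V)) ∷ map (suc v ∷_) (insertZero V)

insertTwoZeros : Word k → List (Word (suc k))
insertTwoZeros [] = [ zero ∷ zero ∷ [] ]
insertTwoZeros (v ∷ V) = map (zero ∷_) (insertZero (v ∷ V)) ++ map (suc v ∷_) (insertTwoZeros V)

∈-insertZero⁻ : ∀ {W} (V : Word k) → W ∈ insertZero V → occurrences zero W ≡ 1 × deleteZeros W ≡ V
∈-insertZero⁻ [] (here refl) = refl , refl
∈-insertZero⁻ (v ∷ V) (here refl) =
  cong suc (occurrences-zero-map-suc (v ∷ V)) , deleteZeros-map-suc (v ∷ V)
∈-insertZero⁻ (v ∷ V) (there W∈) with _ , W′∈ , refl ← ∈-map⁻ (suc v ∷_) W∈ =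
  map₂ (cong (v ∷_)) (∈-insertZero⁻ V W′∈)

zero∷map-suc∈insertZero : ∀ (V : Word k) → zero ∷ map suc V ∈ insertZero V
zero∷map-suc∈insertZero [] = here refl
zero∷map-suc∈insertZero (v ∷ V) = here refl

∈-insertZero⁺ : ∀ (W : Word (suc k)) → occurrences zero W ≡ 1 → W ∈ insertZero (deleteZeros W)
∈-insertZero⁺ (zero ∷ W) eq =
  subst (λ U → zero ∷ U ∈ insertZero (deleteZeros W))
    (sym (occurrences-zero≡0⇒map-suc W (suc-injective eq))) (zero∷map-suc∈insertZero (deleteZeros W))
∈-insertZero⁺ (suc a ∷ W) eq = there (∈-map⁺ (suc a ∷_) (∈-insertZero⁺ W eq))

∈-insertTwoZeros⁻ : ∀ {W} (V : Word k) → W ∈ insertTwoZeros V →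
  occurrences zero W ≡ 2 × deleteZeros W ≡ V
∈-insertTwoZeros⁻ [] (here refl) = refl , refl
∈-insertTwoZeros⁻ (v ∷ V) W∈ with ∈-++⁻ (map (zero ∷_) (insertZero (v ∷ V))) W∈
... | inj₁ W∈₁ with _ , W′∈ , refl ← ∈-map⁻ (zero ∷_) W∈₁ =
  map₁ (cong suc) (∈-insertZero⁻ (v ∷ V) W′∈)
... | inj₂ W∈₂ with _ , W′∈ , refl ← ∈-map⁻ (suc v ∷_) W∈₂ =
  map₂ (cong (v ∷_)) (∈-insertTwoZeros⁻ V W′∈)

zero∷-∈-insertTwoZeros : ∀ {W} (V : Word k) → W ∈ insertZero V → zero ∷ W ∈ insertTwoZeros V
zero∷-∈-insertTwoZeros [] (here refl) = here refl
zero∷-∈-insertTwoZeros (v ∷ V) W∈ = ∈-++⁺ˡ (∈-map⁺ (zero ∷_) W∈)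

∈-insertTwoZeros⁺ : ∀ (W : Word (suc k)) → occurrences zero W ≡ 2 → W ∈ insertTwoZeros (deleteZeros W)
∈-insertTwoZeros⁺ (zero ∷ W) eq =
  zero∷-∈-insertTwoZeros (deleteZeros W) (∈-insertZero⁺ W (suc-injective eq))
∈-insertTwoZeros⁺ (suc a ∷ W) eq =
  ∈-++⁺ʳ (map (zero ∷_) (insertZero (a ∷ deleteZeros W))) (∈-map⁺ (suc a ∷_) (∈-insertTwoZeros⁺ W eq))

insertZero-unique : ∀ (V : Word k) → Unique (insertZero V)
insertZero-unique [] = All.[] ∷ []
insertZero-unique (v ∷ V) =
  All.map⁺ (All.universal (λ _ ()) _) ∷ Unique.map⁺ ∷-injectiveʳ (insertZero-unique V)

insertTwoZeros-unique : ∀ (V : Word k) → Unique (insertTwoZeros V)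
insertTwoZeros-unique [] = All.[] ∷ []
insertTwoZeros-unique (v ∷ V) =
  Unique.++⁺ (Unique.map⁺ ∷-injectiveʳ (insertZero-unique (v ∷ V)))
             (Unique.map⁺ ∷-injectiveʳ (insertTwoZeros-unique V)) disjoint
  where
  disjoint : ∀ {W} → ¬ (W ∈ map (zero ∷_) (insertZero (v ∷ V)) × W ∈ map (suc v ∷_) (insertTwoZeros V))
  disjoint (W∈₁ , W∈₂) with _ , _ , refl ← ∈-map⁻ (zero ∷_) W∈₁ | _ , _ , () ← ∈-map⁻ (suc v ∷_) W∈₂

length-insertZero : ∀ (V : Word k) → length (insertZero V) ≡ suc (length V)
length-insertZero [] = refl
length-insertZero (v ∷ V) = cong suc (trans (length-map _ (insertZero V)) (length-insertZero V))

length-insertTwoZeros : ∀ (V : Word k) → length (insertTwoZeros V) ≡ triangular (suc (length V))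
length-insertTwoZeros [] = refl
length-insertTwoZeros (v ∷ V) = begin
  length (map (zero ∷_) (insertZero (v ∷ V)) ++ map (suc v ∷_) (insertTwoZeros V))
    ≡⟨ length-++ (map (zero ∷_) (insertZero (v ∷ V))) ⟩
  length (map (zero ∷_) (insertZero (v ∷ V))) + length (map (suc v ∷_) (insertTwoZeros V))
    ≡⟨ cong₂ _+_ (length-map _ (insertZero (v ∷ V))) (length-map _ (insertTwoZeros V)) ⟩
  length (insertZero (v ∷ V)) + length (insertTwoZeros V)
    ≡⟨ cong₂ _+_ (length-insertZero (v ∷ V)) (length-insertTwoZeros V) ⟩
  triangular (suc (length (v ∷ V)))
    ∎
  where open ≡-Reasoning

doubleOccurrenceWords : ∀ k → List (Word k)
doubleOccurrenceWords zero = [ [] ]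
doubleOccurrenceWords (suc k) = concatMap insertTwoZeros (doubleOccurrenceWords k)

∈-doubleOccurrenceWords⁻ : ∀ {k} {W : Word k} → W ∈ doubleOccurrenceWords k → DoubleOccurrence W
∈-doubleOccurrenceWords⁻ {zero} (here refl) ()
∈-doubleOccurrenceWords⁻ {suc k} {W} W∈ z
  with V , V∈ , W∈′ ← find (∈-concatMap⁻ insertTwoZeros {xs = doubleOccurrenceWords k} W∈)
  with zeros , refl ← ∈-insertTwoZeros⁻ V W∈′
  with z
... | zero = zeros
... | suc z = trans (occurrences-suc z W) (∈-doubleOccurrenceWords⁻ V∈ z)

∈-doubleOccurrenceWords⁺ : ∀ {k} {W : Word k} → DoubleOccurrence W → W ∈ doubleOccurrenceWords k
∈-doubleOccurrenceWords⁺ {zero} {[]} _ = here refl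
∈-doubleOccurrenceWords⁺ {suc k} {W} twice =
  ∈-concatMap⁺ insertTwoZeros {xs = doubleOccurrenceWords k}
    (lose (∈-doubleOccurrenceWords⁺ {W = deleteZeros W} twice′) (∈-insertTwoZeros⁺ W (twice zero)))
  where
  twice′ : DoubleOccurrence (deleteZeros W)
  twice′ z = trans (sym (occurrences-suc z W)) (twice (suc z))

doubleOccurrenceWords-unique : ∀ k → Unique (doubleOccurrenceWords k)
doubleOccurrenceWords-unique zero = All.[] ∷ []
doubleOccurrenceWords-unique (suc k) =
  concatMap-unique insertTwoZeros (doubleOccurrenceWords-unique k) insertTwoZeros-unique
    (λ {V} {V′} W∈ W∈′ → trans (sym (proj₂ (∈-insertTwoZeros⁻ V W∈))) (proj₂ (∈-insertTwoZeros⁻ V′ W∈′)))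

∈-doubleOccurrenceWords⇒length : ∀ {k} {W : Word k} → W ∈ doubleOccurrenceWords k → length W ≡ 2 * k
∈-doubleOccurrenceWords⇒length {zero} (here refl) = refl
∈-doubleOccurrenceWords⇒length {suc k} {W} W∈
  with V , V∈ , W∈′ ← find (∈-concatMap⁻ insertTwoZeros {xs = doubleOccurrenceWords k} W∈)
  with zeros , refl ← ∈-insertTwoZeros⁻ V W∈′ = begin
    length W                                     ≡⟨ length-deleteZeros W ⟩
    occurrences zero W + length (deleteZeros W)  ≡⟨ cong₂ _+_ zeros (∈-doubleOccurrenceWords⇒length V∈) ⟩
    2 + 2 * k                                    ≡⟨ *-suc 2 k ⟨
    2 * suc k                                    ∎
  where open ≡-Reasoning

length-doubleOccurrenceWords : ∀ k → length (doubleOccurrenceWords k) * 2 ^ k ≡ (2 * k) !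
length-doubleOccurrenceWords zero = refl
length-doubleOccurrenceWords (suc k) = begin
  length (doubleOccurrenceWords (suc k)) * 2 ^ suc k
    ≡⟨ cong (_* 2 ^ suc k) (length-concatMap insertTwoZeros insertions) ⟩
  L * triangular (suc (2 * k)) * (2 * 2 ^ k)
    ≡⟨ regroup L (triangular (suc (2 * k))) (2 ^ k) ⟩
  2 * triangular (suc (2 * k)) * (L * 2 ^ k)
    ≡⟨ cong₂ _*_ (2*triangular (suc (2 * k))) (length-doubleOccurrenceWords k) ⟩
  suc (2 * k) * suc (suc (2 * k)) * (2 * k) !
    ≡⟨ reorder (suc (2 * k)) (suc (suc (2 * k))) ((2 * k) !) ⟩
  suc (suc (2 * k)) !
    ≡⟨ cong _! (*-suc 2 k) ⟨
  (2 * suc k) !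
    ∎
  where
  open ≡-Reasoning
  L = length (doubleOccurrenceWords k)
  insertions : ∀ {V} → V ∈ doubleOccurrenceWords k → length (insertTwoZeros V) ≡ triangular (suc (2 * k))
  insertions {V} V∈ =
    trans (length-insertTwoZeros V) (cong (triangular ∘ suc) (∈-doubleOccurrenceWords⇒length V∈))
  regroup : ∀ a t p → a * t * (2 * p) ≡ 2 * t * (a * p)
  regroup = solve-∀
  reorder : ∀ a b c → a * b * c ≡ b * (a * c)
  reorder = solve-∀

lemma2p3 : (k : ℕ) → 1 ≤ k →
    Σ (List (Word k)) λ L →
    Unique L × ((W : Word k) → (W ∈ L) ⇔ Extremal W) × (length L ≡ count k)
lemma2p3 k _ =
  map double (doubleOccurrenceWords k) ,
  Unique.map⁺ double-injective (doubleOccurrenceWords-unique k) ,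
  (λ W → mk⇔ listed⇒extremal extremal⇒listed) ,
  (begin
    length (map double (doubleOccurrenceWords k))    ≡⟨ length-map double (doubleOccurrenceWords k) ⟩
    length (doubleOccurrenceWords k)                 ≡⟨ m*n/n≡m _ (2 ^ k) ⟨
    length (doubleOccurrenceWords k) * 2 ^ k / 2 ^ k ≡⟨ cong (_/ 2 ^ k) (length-doubleOccurrenceWords k) ⟩
    count k                                          ∎)
  where
  open ≡-Reasoning
  instance
    2^k≢0 : NonZero (2 ^ k)
    2^k≢0 = m^n≢0 2 k
  listed⇒extremal : ∀ {W} → W ∈ map double (doubleOccurrenceWords k) → Extremal W
  listed⇒extremal W∈ with V , V∈ , refl ← ∈-map⁻ double W∈ =
    double-extremal (∈-doubleOccurrenceWords⁻ V∈)
  extremal⇒listed : ∀ {W} → Extremal W → W ∈ map double (doubleOccurrenceWords k)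
  extremal⇒listed E with V , twice , refl ← extremal⇒double E =
    ∈-map⁺ double (∈-doubleOccurrenceWords⁺ twice)
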